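{- Let $G=(V,E)$ be a finite simple graph with non-negative edge-weights $w:E\to\mathbb{N}$ that admits a minimum-weight perfect matching $M$. For an integer $r\ge w(M)$ define $w':E\to\mathbb{Z}$ by $w'(e)=-w(e)-r-1$ if $e\in M$ and $w'(e)=w(e)+r+1$ if $e\notin M$. Then every cycle $C$ of $G$ with $w'(C)\le r-w(M)$ is $M$-alternating, and $w'$ is conservative.
   Context: For $X\subseteq E$, $w(X)=\sum_{e\in X}w(e)$ and similarly for $w'$. An even cycle $C$ is $M$-alternating if its edges alternate between edges in $M$ and edges not in $M$. Weights are conservative if no cycle of $G$ has negative total weight. -}

module Defs where

open import Data.Nat as ℕ using (ℕ; zero; suc; _≤_)
open import Data.Nat.DivMod using (_%_; m%n<n)
open import Data.Nat.Divisibility using (_∣_)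
open import Data.Fin using (Fin; toℕ; fromℕ<)
import Data.Fin as F
open import Data.Bool using (Bool; true; false; not; if_then_else_)
open import Data.Integer as ℤ using (ℤ; +_)
open import Data.Product using (_×_; _,_; proj₁; proj₂; ∃)
open import Data.Sum using (_⊎_)
open import Relation.Binary.PropositionalEquality using (_≡_; _≢_)
open import Function.Definitions using (Injective)

sumℕ : (k : ℕ) → (Fin k → ℕ) → ℕ
sumℕ zero    f = 0
sumℕ (suc k) f = f F.zero ℕ.+ sumℕ k (λ i → f (F.suc i))

sumℤ : (k : ℕ) → (Fin k → ℤ) → ℤ
sumℤ zero    f = + 0
sumℤ (suc k) f = f F.zero ℤ.+ sumℤ k (λ i → f (F.suc i))

next : {k : ℕ} → Fin k → Fin k
next {suc k} i = fromℕ< (m%n<n (suc (toℕ i)) (suc k))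

record Graph : Set where
  field
    n m  : ℕ
    ends : Fin m → Fin n × Fin n

  Joins : Fin m → Fin n → Fin n → Set
  Joins e u v = ends e ≡ (u , v) ⊎ ends e ≡ (v , u)

  Inc : Fin m → Fin n → Set
  Inc e v = proj₁ (ends e) ≡ v ⊎ proj₂ (ends e) ≡ v

  field
    loopless : ∀ e → proj₁ (ends e) ≢ proj₂ (ends e)
    noParallel : ∀ e f u v → Joins e u v → Joins f u v → e ≡ f

open Graph public

EdgeSet : Graph → Set
EdgeSet G = Fin (m G) → Bool

IsPerfectMatching : (G : Graph) → EdgeSet G → Set
IsPerfectMatching G M =
  ∀ v → ∃ (λ e → M e ≡ true × Inc G e v)
      × (∀ e f → M e ≡ true → M f ≡ true → Inc G e v → Inc G f v → e ≡ f)

weight : (G : Graph) → (Fin (m G) → ℕ) → EdgeSet G → ℕ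
weight G w X = sumℕ (m G) (λ e → if X e then w e else 0)

IsMinWeightPerfectMatching : (G : Graph) → (Fin (m G) → ℕ) → EdgeSet G → Set
IsMinWeightPerfectMatching G w M =
  IsPerfectMatching G M × (∀ M′ → IsPerfectMatching G M′ → weight G w M ≤ weight G w M′)

record Cycle (G : Graph) : Set where
  field
    len    : ℕ
    len≥3  : 3 ≤ len
    vtx    : Fin len → Fin (n G)
    vtxInj : Injective _≡_ _≡_ vtx
    edge   : Fin len → Fin (m G)
    joins  : ∀ i → Joins G (edge i) (vtx i) (vtx (next i))

open Cycle public

cycleWeight : {G : Graph} → (Fin (m G) → ℤ) → Cycle G → ℤ
cycleWeight w′ C = sumℤ (len C) (λ i → w′ (edge C i))

IsAlternating : {G : Graph} → EdgeSet G → Cycle G → Set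
IsAlternating M C = (2 ∣ len C) × (∀ i → M (edge C i) ≡ not (M (edge C (next i))))

Conservative : (G : Graph) → (Fin (m G) → ℤ) → Set
Conservative G w′ = ∀ (C : Cycle G) → + 0 ℤ.≤ cycleWeight w′ C

w′ : (G : Graph) → (Fin (m G) → ℕ) → EdgeSet G → ℤ → Fin (m G) → ℤ
w′ G w M r e =
  if M e then ℤ.- (+ w e) ℤ.- r ℤ.- + 1 else (+ w e) ℤ.+ r ℤ.+ + 1

-- Let a, b be the numbers of edges of a cycle C inside and outside M, and A, B their w-weights, so that
-- w′(C) = (B − A) + (b − a)(r + 1). As M is a matching, i ↦ i + 1 sends the M-edges of C injectively to
-- non-M-edges, so a ≤ b, with equality exactly when C is M-alternating. If a < b then, as A ≤ w(M),
-- w′(C) ≥ r + 1 − w(M), which exceeds r − w(M) and is positive; so light cycles have a = b. If a = b, then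
-- M ⊕ C is a perfect matching of weight w(M) − A + B, and minimality of M gives A ≤ B, i.e. w′(C) ≥ 0.
module Submission where

open import Defs
open import Data.Nat using (ℕ; zero; suc; _+_; _*_; z≤n; s≤s)
open import Data.Nat.Properties
  using ( module ≤-Reasoning; ≤-refl; ≤-reflexive; ≤-trans; ≤-antisym; <-≤-trans; <⇒≤; <⇒≱; m≤n⇒m<n∨m≡n
        ; +-suc; +-identityʳ; +-mono-≤; +-monoˡ-≤; +-monoʳ-≤; +-monoˡ-<; +-cancelˡ-≤; +-cancelʳ-≤
        ; +-cancelˡ-<; *-comm; *-monoˡ-≤; m<m+n; m≤n+m; m+1+n≢n; +-commutativeSemigroup)
open import Data.Nat.DivMod using (_%_; m%n<n; n%n≡0; m<n⇒m%n≡m)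
open import Data.Nat.Divisibility using (divides)
open import Data.Integer as ℤ using (ℤ; +_; +≤+; _-_)
open import Data.Integer.Properties as ℤ using (drop‿+≤+; i≤j⇒0≤j-i)
open import Data.Integer.Tactic.RingSolver using (solve-∀)
open import Data.Fin using (Fin; zero; suc; toℕ; fromℕ; inject₁)
open import Data.Fin.Properties
  using (_≟_; any?; toℕ-injective; toℕ-fromℕ<; toℕ-fromℕ; toℕ-inject₁; toℕ<n; suc-injective; 0≢1+n)
open import Data.Fin.Relation.Unary.Top using (view; ‵fromℕ; ‵inject₁)
open import Data.Bool using (Bool; true; false; not; _xor_; if_then_else_)
open import Data.Product using (_×_; _,_; proj₁; proj₂; ∃)
open import Data.Sum using (_⊎_; inj₁; inj₂; [_,_]′; swap)
open import Relation.Nullary using (yes; no; does; contradiction)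
open import Relation.Nullary.Decidable using (dec-true; dec-false)
open import Relation.Binary.PropositionalEquality
open import Function.Base using (_∘_)
open import Function.Definitions using (Injective)
open import Algebra.Properties.CommutativeSemigroup +-commutativeSemigroup using (interchange; x∙yz≈y∙xz)

-- ℕ's order is opened only inside this module, so that _≤_ in the theorem at the end is ℤ's.
module _ where
  open import Data.Nat using (_≤_; _<_)

  sum-cong : ∀ k {f g : Fin k → ℕ} → (∀ i → f i ≡ g i) → sumℕ k f ≡ sumℕ k g
  sum-cong zero    f≗g = refl
  sum-cong (suc k) f≗g = cong₂ _+_ (f≗g zero) (sum-cong k (f≗g ∘ suc))

  sum-mono : ∀ k {f g : Fin k → ℕ} → (∀ i → f i ≤ g i) → sumℕ k f ≤ sumℕ k g
  sum-mono zero    f≤g = z≤n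
  sum-mono (suc k) f≤g = +-mono-≤ (f≤g zero) (sum-mono k (f≤g ∘ suc))

  sum-zeros : ∀ k → sumℕ k (λ _ → 0) ≡ 0
  sum-zeros zero    = refl
  sum-zeros (suc k) = sum-zeros k

  sum-+ : ∀ k (f g : Fin k → ℕ) → sumℕ k (λ i → f i + g i) ≡ sumℕ k f + sumℕ k g
  sum-+ zero    f g = refl
  sum-+ (suc k) f g =
    trans (cong (_+_ (f zero + g zero)) (sum-+ k (f ∘ suc) (g ∘ suc)))
          (interchange (f zero) (g zero) (sumℕ k (f ∘ suc)) (sumℕ k (g ∘ suc)))

  sum-mono-reflects-≡ : ∀ k {f g : Fin k → ℕ} → (∀ i → f i ≤ g i) → sumℕ k g ≤ sumℕ k f →
                        ∀ i → f i ≡ g i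
  sum-mono-reflects-≡ (suc k) {f} {g} f≤g g≤f zero =
    ≤-antisym (f≤g zero) (+-cancelʳ-≤ _ _ _ (≤-trans g≤f (+-monoʳ-≤ (f zero) (sum-mono k (f≤g ∘ suc)))))
  sum-mono-reflects-≡ (suc k) {f} {g} f≤g g≤f (suc i) =
    sum-mono-reflects-≡ k (f≤g ∘ suc)
      (+-cancelˡ-≤ (g zero) _ _ (≤-trans g≤f (+-monoˡ-≤ _ (f≤g zero)))) i

  sumWhere : ∀ k → (Fin k → Bool) → (Fin k → ℕ) → ℕ
  sumWhere k p f = sumℕ k (λ i → if p i then f i else 0)

  sumWhere-+ : ∀ k p (f g : Fin k → ℕ) →
               sumWhere k p (λ i → f i + g i) ≡ sumWhere k p f + sumWhere k p g
  sumWhere-+ k p f g = trans (sum-cong k (λ i → if-+ (p i))) (sum-+ k _ _)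
    where
    if-+ : ∀ b {x y} → (if b then x + y else 0) ≡ (if b then x else 0) + (if b then y else 0)
    if-+ true  = refl
    if-+ false = refl

  count : ∀ k → (Fin k → Bool) → ℕ
  count k p = sumWhere k p (λ _ → 1)

  sumWhere-≤ : ∀ k p (f : Fin k → ℕ) → sumWhere k p f ≤ sumℕ k f
  sumWhere-≤ k p f = sum-mono k (λ i → if-≤ (p i))
    where
    if-≤ : ∀ b {x} → (if b then x else 0) ≤ x
    if-≤ true  = ≤-refl
    if-≤ false = z≤n

  sumWhere-const : ∀ k p c → sumWhere k p (λ _ → c) ≡ count k p * c
  sumWhere-const zero    p c = refl
  sumWhere-const (suc k) p c with p zero
  ... | true  = cong (_+_ c) (sumWhere-const k (p ∘ suc) c)
  ... | false = sumWhere-const k (p ∘ suc) c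

  count+count-not : ∀ k (p : Fin k → Bool) → count k p + count k (not ∘ p) ≡ k
  count+count-not zero    p = refl
  count+count-not (suc k) p with p zero
  ... | true  = cong suc (count+count-not k (p ∘ suc))
  ... | false = trans (+-suc (count k (p ∘ suc)) _) (cong suc (count+count-not k (p ∘ suc)))

  indicator-injective : ∀ x y → (if x then 1 else 0) ≡ (if y then 1 else 0) → x ≡ y
  indicator-injective true  true  _ = refl
  indicator-injective false false _ = refl

  inImage : ∀ {k l} → (Fin k → Fin l) → Fin l → Bool
  inImage g e = does (any? λ i → g i ≟ e)

  inImage-witness : ∀ {k l} {g : Fin k → Fin l} {e} → inImage g e ≡ true → ∃ λ i → g i ≡ e
  inImage-witness {g = g} {e} p with any? (λ i → g i ≟ e)
  ... | yes g⁻¹e = g⁻¹e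

  sum-at : ∀ l (j : Fin l) (h : Fin l → ℕ) → sumℕ l (λ e → if does (j ≟ e) then h e else 0) ≡ h j
  sum-at (suc l) zero    h = trans (cong (_+_ (h zero)) (sum-zeros l)) (+-identityʳ (h zero))
  sum-at (suc l) (suc j) h = sum-at l j (h ∘ suc)

  sum-image : ∀ {k} l (g : Fin k → Fin l) → Injective _≡_ _≡_ g → (h : Fin l → ℕ) →
              sumWhere l (inImage g) h ≡ sumℕ k (h ∘ g)
  sum-image {zero}  l g g-inj h = sum-zeros l
  sum-image {suc k} l g g-inj h = begin
    sumWhere l (inImage g) h
      ≡⟨ sum-cong l split ⟩
    sumℕ l (λ e → (if does (g zero ≟ e) then h e else 0) + (if inImage (g ∘ suc) e then h e else 0))
      ≡⟨ sum-+ l _ _ ⟩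
    sumℕ l (λ e → if does (g zero ≟ e) then h e else 0) + sumWhere l (inImage (g ∘ suc)) h
      ≡⟨ cong₂ _+_ (sum-at l (g zero) h) (sum-image l (g ∘ suc) (suc-injective ∘ g-inj) h) ⟩
    h (g zero) + sumℕ k (h ∘ g ∘ suc) ∎
    where
    open ≡-Reasoning
    split : ∀ e → (if inImage g e then h e else 0) ≡
                  (if does (g zero ≟ e) then h e else 0) + (if inImage (g ∘ suc) e then h e else 0)
    split e with g zero ≟ e
    ... | yes refl
      rewrite dec-false (any? λ i → g (suc i) ≟ g zero) (λ (i , gi≡g0) → 0≢1+n (sym (g-inj gi≡g0)))
      = sym (+-identityʳ (h (g zero)))
    ... | no _     = refl

  sum-injective-≤ : ∀ {k} l (g : Fin k → Fin l) → Injective _≡_ _≡_ g → (h : Fin l → ℕ) →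
                    sumℕ k (h ∘ g) ≤ sumℕ l h
  sum-injective-≤ l g g-inj h = ≤-trans (≤-reflexive (sym (sum-image l g g-inj h))) (sumWhere-≤ l _ h)

  next-fromℕ : ∀ k → next (fromℕ k) ≡ zero
  next-fromℕ k = toℕ-injective (begin
    toℕ (next (fromℕ k))        ≡⟨ toℕ-fromℕ< (m%n<n (suc (toℕ (fromℕ k))) (suc k)) ⟩
    suc (toℕ (fromℕ k)) % suc k ≡⟨ cong (λ x → suc x % suc k) (toℕ-fromℕ k) ⟩
    suc k % suc k               ≡⟨ n%n≡0 (suc k) ⟩
    0                           ∎)
    where open ≡-Reasoning

  next-inject₁ : ∀ {k} (i : Fin k) → next (inject₁ i) ≡ suc i
  next-inject₁ {k} i = toℕ-injective (begin
    toℕ (next (inject₁ i))        ≡⟨ toℕ-fromℕ< (m%n<n (suc (toℕ (inject₁ i))) (suc k)) ⟩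
    suc (toℕ (inject₁ i)) % suc k ≡⟨ cong (λ x → suc x % suc k) (toℕ-inject₁ i) ⟩
    suc (toℕ i) % suc k           ≡⟨ m<n⇒m%n≡m (s≤s (toℕ<n i)) ⟩
    suc (toℕ i)                   ∎)
    where open ≡-Reasoning

  prev : ∀ {k} → Fin k → Fin k
  prev {suc k} zero    = fromℕ k
  prev {suc k} (suc i) = inject₁ i

  next-prev : ∀ {k} (i : Fin k) → next (prev i) ≡ i
  next-prev {suc k} zero    = next-fromℕ k
  next-prev {suc k} (suc i) = next-inject₁ i

  next-injective : ∀ {k} → Injective _≡_ _≡_ (next {k})
  next-injective {suc k} {i} {j} eq with view i | view j
  ... | ‵fromℕ     | ‵fromℕ     = refl
  ... | ‵fromℕ     | ‵inject₁ j =
    contradiction (trans (sym (next-fromℕ k)) (trans eq (next-inject₁ j))) 0≢1+n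
  ... | ‵inject₁ i | ‵fromℕ     =
    contradiction (trans (sym (next-fromℕ k)) (trans (sym eq) (next-inject₁ i))) 0≢1+n
  ... | ‵inject₁ i | ‵inject₁ j =
    cong inject₁ (suc-injective (trans (sym (next-inject₁ i)) (trans eq (next-inject₁ j))))

  prev-next : ∀ {k} (i : Fin k) → prev (next i) ≡ i
  prev-next i = next-injective (next-prev (next i))

  next²-irreflexive : ∀ {k} → 3 ≤ k → (i : Fin k) → next (next i) ≢ i
  next²-irreflexive {suc (suc (suc k))} (s≤s (s≤s (s≤s _))) i with view i
  ... | ‵fromℕ = λ eq → 0≢1+n (suc-injective (begin
    suc zero                      ≡⟨ next-inject₁ zero ⟨
    next zero                     ≡⟨ cong next (next-fromℕ (2 + k)) ⟨
    next (next (fromℕ (2 + k)))   ≡⟨ eq ⟩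
    fromℕ (2 + k)                 ∎))
    where open ≡-Reasoning
  ... | ‵inject₁ j rewrite next-inject₁ j with view j
  ...   | ‵fromℕ     = 0≢1+n ∘ trans (sym (next-fromℕ (2 + k)))
  ...   | ‵inject₁ j′ = λ eq → m+1+n≢n 1 (begin
    suc (suc (toℕ j′))              ≡⟨ cong toℕ (sym (next-inject₁ (suc j′))) ⟩
    toℕ (next (inject₁ (suc j′)))   ≡⟨ cong toℕ eq ⟩
    toℕ (inject₁ (inject₁ j′))      ≡⟨ trans (toℕ-inject₁ (inject₁ j′)) (toℕ-inject₁ j′) ⟩
    toℕ j′                          ∎)
    where open ≡-Reasoning

  module _ {G : Graph} (C : Cycle G) where

    edge-incident-here : ∀ i → Inc G (edge C i) (vtx C i)
    edge-incident-here i with joins C i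
    ... | inj₁ ends≡ = inj₁ (cong proj₁ ends≡)
    ... | inj₂ ends≡ = inj₂ (cong proj₂ ends≡)

    edge-incident-there : ∀ i → Inc G (edge C i) (vtx C (next i))
    edge-incident-there i with joins C i
    ... | inj₁ ends≡ = inj₂ (cong proj₂ ends≡)
    ... | inj₂ ends≡ = inj₁ (cong proj₁ ends≡)

    edge-endpoints : ∀ i {u} → Inc G (edge C i) u → u ≡ vtx C i ⊎ u ≡ vtx C (next i)
    edge-endpoints i inc with joins C i | inc
    ... | inj₁ ends≡ | inj₁ fst≡u = inj₁ (trans (sym fst≡u) (cong proj₁ ends≡))
    ... | inj₁ ends≡ | inj₂ snd≡u = inj₂ (trans (sym snd≡u) (cong proj₂ ends≡))
    ... | inj₂ ends≡ | inj₁ fst≡u = inj₂ (trans (sym fst≡u) (cong proj₁ ends≡))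
    ... | inj₂ ends≡ | inj₂ snd≡u = inj₁ (trans (sym snd≡u) (cong proj₂ ends≡))

    edge-endpoint-index : ∀ i j → Inc G (edge C i) (vtx C j) → j ≡ i ⊎ j ≡ next i
    edge-endpoint-index i j inc with edge-endpoints i inc
    ... | inj₁ vj≡vi     = inj₁ (vtxInj C vj≡vi)
    ... | inj₂ vj≡vnexti = inj₂ (vtxInj C vj≡vnexti)

    edge-incident-prev : ∀ j → Inc G (edge C (prev j)) (vtx C j)
    edge-incident-prev j =
      subst (λ i → Inc G (edge C (prev j)) (vtx C i)) (next-prev j) (edge-incident-there (prev j))

    incident-cycle-edge : ∀ i j → Inc G (edge C i) (vtx C j) →
                          edge C i ≡ edge C j ⊎ edge C i ≡ edge C (prev j)
    incident-cycle-edge i j inc with edge-endpoint-index i j inc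
    ... | inj₁ j≡i     = inj₁ (cong (edge C) (sym j≡i))
    ... | inj₂ j≡nexti = inj₂ (cong (edge C) (trans (sym (prev-next i)) (cong prev (sym j≡nexti))))

    edge-on-cycle : ∀ i → inImage (edge C) (edge C i) ≡ true
    edge-on-cycle i = dec-true (any? λ j → edge C j ≟ edge C i) (i , refl)

    edge-injective : Injective _≡_ _≡_ (edge C)
    edge-injective {i} {j} eq
      with edge-endpoint-index j i (subst (λ e → Inc G e (vtx C i)) eq (edge-incident-here i))
         | edge-endpoint-index j (next i) (subst (λ e → Inc G e (vtx C (next i))) eq (edge-incident-there i))
    ... | inj₁ i≡j     | _              = i≡j
    ... | inj₂ _       | inj₂ ni≡nj     = next-injective ni≡nj
    ... | inj₂ i≡nj    | inj₁ ni≡j      =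
      contradiction (trans (cong next (sym i≡nj)) ni≡j) (next²-irreflexive (len≥3 C) j)

  MatchedOnce : (G : Graph) → EdgeSet G → Fin (n G) → Set
  MatchedOnce G X u =
    ∃ (λ e → X e ≡ true × Inc G e u) × (∀ e f → X e ≡ true → X f ≡ true → Inc G e u → Inc G f u → e ≡ f)

  matchedOnce : ∀ G (X : EdgeSet G) {u} e → X e ≡ true → Inc G e u →
                (∀ f → X f ≡ true → Inc G f u → f ≡ e) → MatchedOnce G X u
  matchedOnce G X e Xe e∋u unique =
    (e , Xe , e∋u) , λ f f′ Xf Xf′ f∋u f′∋u → trans (unique f Xf f∋u) (sym (unique f′ Xf′ f′∋u))

  matchedOnce-cong : ∀ G {X Y : EdgeSet G} {u} → (∀ e → Inc G e u → X e ≡ Y e) →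
                     MatchedOnce G X u → MatchedOnce G Y u
  matchedOnce-cong G X≗Y ((e , Xe , e∋u) , unique) =
    (e , trans (sym (X≗Y e e∋u)) Xe , e∋u) ,
    λ f f′ Yf Yf′ f∋u f′∋u → unique f f′ (trans (X≗Y f f∋u) Yf) (trans (X≗Y f′ f′∋u) Yf′) f∋u f′∋u

  _⊕_ : {G : Graph} → EdgeSet G → Cycle G → EdgeSet G
  (M ⊕ C) e = inImage (edge C) e xor M e

  module _ {G : Graph} (M : EdgeSet G) (C : Cycle G) where

    onM : Fin (len C) → Bool
    onM i = M (edge C i)

    Alternating : Set
    Alternating = ∀ i → onM i ≡ not (onM (next i))

    alternating-prev : Alternating → ∀ j → M (edge C (prev j)) ≡ not (M (edge C j))
    alternating-prev alternating j =
      trans (alternating (prev j)) (cong (λ i → not (M (edge C i))) (next-prev j))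

    ⊕-on-cycle : ∀ i → (M ⊕ C) (edge C i) ≡ not (M (edge C i))
    ⊕-on-cycle i = cong (_xor M (edge C i)) (edge-on-cycle C i)

    ⊕-off-cycle : ∀ {e} → inImage (edge C) e ≡ false → (M ⊕ C) e ≡ M e
    ⊕-off-cycle {e} e∉C = cong (_xor M e) e∉C

  module _ {G : Graph} {M : EdgeSet G} (perfect : IsPerfectMatching G M) (C : Cycle G) where

    matching-not-consecutive : ∀ i → M (edge C i) ≡ true → M (edge C (next i)) ≡ false
    matching-not-consecutive i Mi with M (edge C (next i)) in Mnexti
    ... | false = refl
    ... | true  = contradiction
      (trans (cong next (sym i≡nexti)) (sym i≡nexti))
      (next²-irreflexive (len≥3 C) i)
      where
      i≡nexti : i ≡ next i
      i≡nexti = edge-injective C (proj₂ (perfect (vtx C (next i))) _ _ Mi Mnexti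
                                       (edge-incident-there C i) (edge-incident-here C (next i)))

    private
      L = len C

      onM⇒next-offM : ∀ i → (if onM M C i then 1 else 0) ≤ (if not (onM M C (next i)) then 1 else 0)
      onM⇒next-offM i with M (edge C i) in Mi
      ... | true rewrite matching-not-consecutive i Mi = ≤-refl
      ... | false = z≤n

      count-next : sumℕ L (λ i → if not (onM M C (next i)) then 1 else 0) ≤ count L (not ∘ onM M C)
      count-next = sum-injective-≤ L next next-injective (λ i → if not (onM M C i) then 1 else 0)

    count-onM≤count-offM : count L (onM M C) ≤ count L (not ∘ onM M C)
    count-onM≤count-offM = ≤-trans (sum-mono L onM⇒next-offM) count-next

    balanced⇒alternating : count L (onM M C) ≡ count L (not ∘ onM M C) → IsAlternating M C
    balanced⇒alternating balanced = divides a len≡a*2 , alternating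
      where
      a = count L (onM M C)
      alternating : Alternating M C
      alternating i = indicator-injective _ _
        (sum-mono-reflects-≡ L onM⇒next-offM (≤-trans count-next (≤-reflexive (sym balanced))) i)
      len≡a*2 : L ≡ a * 2
      len≡a*2 = begin
        L                               ≡⟨ sym (count+count-not L (onM M C)) ⟩
        a + count L (not ∘ onM M C)     ≡⟨ cong (_+_ a) (sym balanced) ⟩
        a + a                           ≡⟨ cong (_+_ a) (sym (+-identityʳ a)) ⟩
        2 * a                           ≡⟨ *-comm 2 a ⟩
        a * 2                           ∎
        where open ≡-Reasoning

    -- e₂ is the cycle edge at u that M uses, e₁ the other one, which M ⊕ C uses instead.
    ⊕-matchedOnce-at : ∀ {u e₁ e₂} → Inc G e₁ u → Inc G e₂ u → (M ⊕ C) e₁ ≡ true →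
                       inImage (edge C) e₂ ≡ true → M e₂ ≡ true →
                       (∀ i → Inc G (edge C i) u → edge C i ≡ e₁ ⊎ edge C i ≡ e₂) →
                       MatchedOnce G (M ⊕ C) u
    ⊕-matchedOnce-at {u} {e₁} {e₂} e₁∋u e₂∋u M⊕e₁ e₂∈C Me₂ cycle-edges =
      matchedOnce G (M ⊕ C) e₁ M⊕e₁ e₁∋u unique
      where
      unique : ∀ f → (M ⊕ C) f ≡ true → Inc G f u → f ≡ e₁
      unique f M⊕f f∋u with inImage (edge C) f in f∈C?
      ... | false = contradiction (trans (sym f∈C?) (subst (λ e → inImage (edge C) e ≡ true) (sym f≡e₂) e₂∈C))
                                  λ ()
        where
        -- off the cycle, M⊕f : M f ≡ true
        f≡e₂ : f ≡ e₂
        f≡e₂ = proj₂ (perfect u) f e₂ M⊕f Me₂ f∋u e₂∋u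
      ... | true with inImage-witness {g = edge C} {f} f∈C?
      ...   | i , refl with cycle-edges i f∋u
      ...     | inj₁ f≡e₁ = f≡e₁
      ...     | inj₂ refl = contradiction (trans (cong not (sym Me₂)) M⊕f) λ ()

    ⊕-perfect : Alternating M C → IsPerfectMatching G (M ⊕ C)
    ⊕-perfect alternating u with any? (λ j → vtx C j ≟ u)
    ... | no u∉C = matchedOnce-cong G (λ e e∋u → sym (⊕-off-cycle M C (off-cycle e e∋u))) (perfect u)
      where
      off-cycle : ∀ e → Inc G e u → inImage (edge C) e ≡ false
      off-cycle e e∋u = dec-false (any? λ i → edge C i ≟ e) λ where
        (i , refl) → u∉C ([ (λ u≡vi → i , sym u≡vi) , (λ u≡vnexti → next i , sym u≡vnexti) ]′
                             (edge-endpoints C i e∋u))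
    ... | yes (j , refl) with M (edge C j) in Mj
    ...   | true  = ⊕-matchedOnce-at (edge-incident-prev C j) (edge-incident-here C j)
                      (trans (⊕-on-cycle M C (prev j)) (cong not (trans M-prev (cong not Mj))))
                      (edge-on-cycle C j) Mj (λ i → swap ∘ incident-cycle-edge C i j)
      where M-prev = alternating-prev M C alternating j
    ...   | false = ⊕-matchedOnce-at (edge-incident-here C j) (edge-incident-prev C j)
                      (trans (⊕-on-cycle M C j) (cong not Mj))
                      (edge-on-cycle C (prev j)) (trans M-prev (cong not Mj))
                      (λ i → incident-cycle-edge C i j)
      where M-prev = alternating-prev M C alternating j

  module _ {G : Graph} (w : Fin (m G) → ℕ) (M : EdgeSet G) (C : Cycle G) where

    weight-onM weight-offM : ℕ
    weight-onM  = sumWhere (len C) (onM M C) (w ∘ edge C)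
    weight-offM = sumWhere (len C) (not ∘ onM M C) (w ∘ edge C)

    weight-onM≤weight : weight-onM ≤ weight G w M
    weight-onM≤weight = sum-injective-≤ (m G) (edge C) (edge-injective C) (λ e → if M e then w e else 0)

    weight-⊕ : weight G w (M ⊕ C) + weight-onM ≡ weight G w M + weight-offM
    weight-⊕ = begin
      weight G w (M ⊕ C) + weight-onM
        ≡⟨ cong (_+_ (weight G w (M ⊕ C))) (sym (sum-image (m G) (edge C) (edge-injective C) onM-weight)) ⟩
      weight G w (M ⊕ C) + sumWhere (m G) (inImage (edge C)) onM-weight
        ≡⟨ sym (sum-+ (m G) _ _) ⟩
      sumℕ (m G) (λ e → (if (M ⊕ C) e then w e else 0) + (if inImage (edge C) e then onM-weight e else 0))
        ≡⟨ sum-cong (m G) (λ e → exchange (inImage (edge C) e) (M e)) ⟩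
      sumℕ (m G) (λ e → onM-weight e + (if inImage (edge C) e then offM-weight e else 0))
        ≡⟨ sum-+ (m G) _ _ ⟩
      weight G w M + sumWhere (m G) (inImage (edge C)) offM-weight
        ≡⟨ cong (_+_ (weight G w M)) (sum-image (m G) (edge C) (edge-injective C) offM-weight) ⟩
      weight G w M + weight-offM ∎
      where
      open ≡-Reasoning
      onM-weight offM-weight : Fin (m G) → ℕ
      onM-weight  e = if M e then w e else 0
      offM-weight e = if not (M e) then w e else 0
      exchange : ∀ c x {k} → (if c xor x then k else 0) + (if c then (if x then k else 0) else 0)
                           ≡ (if x then k else 0) + (if c then (if not x then k else 0) else 0)
      exchange true  true  = sym (+-identityʳ _)
      exchange true  false = +-identityʳ _
      exchange false true  = refl
      exchange false false = refl

  module _ {G : Graph} {w : Fin (m G) → ℕ} {M : EdgeSet G} (minimal : IsMinWeightPerfectMatching G w M)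
           (C : Cycle G) where

    alternating⇒weight-onM≤weight-offM : Alternating M C → weight-onM w M C ≤ weight-offM w M C
    alternating⇒weight-onM≤weight-offM alternating = +-cancelˡ-≤ (weight G w M) _ _ (begin
      weight G w M + weight-onM w M C
        ≤⟨ +-monoˡ-≤ _ (proj₂ minimal (M ⊕ C) (⊕-perfect (proj₁ minimal) C alternating)) ⟩
      weight G w (M ⊕ C) + weight-onM w M C
        ≡⟨ weight-⊕ w M C ⟩
      weight G w M + weight-offM w M C ∎)
      where open ≤-Reasoning

  sumℤ-difference : ∀ k (h : Fin k → ℤ) (f g : Fin k → ℕ) → (∀ i → h i ≡ + f i - + g i) →
                    sumℤ k h ≡ + sumℕ k f - + sumℕ k g
  sumℤ-difference zero    h f g h≗f-g = refl
  sumℤ-difference (suc k) h f g h≗f-g = begin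
    h zero ℤ.+ sumℤ k (h ∘ suc)
      ≡⟨ cong₂ ℤ._+_ (h≗f-g zero) (sumℤ-difference k (h ∘ suc) (f ∘ suc) (g ∘ suc) (h≗f-g ∘ suc)) ⟩
    (+ f zero - + g zero) ℤ.+ (+ sumℕ k (f ∘ suc) - + sumℕ k (g ∘ suc))
      ≡⟨ differences-+ (+ f zero) (+ g zero) (+ sumℕ k (f ∘ suc)) (+ sumℕ k (g ∘ suc)) ⟩
    + (f zero + sumℕ k (f ∘ suc)) - + (g zero + sumℕ k (g ∘ suc)) ∎
    where
    open ≡-Reasoning
    differences-+ : ∀ a b c d → (a - b) ℤ.+ (c - d) ≡ (a ℤ.+ c) - (b ℤ.+ d)
    differences-+ = solve-∀

  differences-≤ : ∀ {x y u v} → + x - + y ℤ.≤ + u - + v → v + x ≤ u + y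
  differences-≤ {x} {y} {u} {v} x-y≤u-v =
    drop‿+≤+ (subst₂ ℤ._≤_ (cancelʳ (+ x) (+ y) (+ v)) (cancelˡ (+ u) (+ v) (+ y))
                          (ℤ.+-monoˡ-≤ (+ v ℤ.+ + y) x-y≤u-v))
    where
    cancelʳ : ∀ a b c → (a - b) ℤ.+ (c ℤ.+ b) ≡ c ℤ.+ a
    cancelʳ = solve-∀
    cancelˡ : ∀ a b c → (a - b) ℤ.+ (b ℤ.+ c) ≡ a ℤ.+ c
    cancelˡ = solve-∀

  unbalanced-gap : ∀ {a b A B W} R → a < b → A ≤ W → R + (A + a * (R + 1)) < W + (B + b * (R + 1))
  unbalanced-gap {a} {b} {A} {B} {W} R a<b A≤W = begin-strict
    R + (A + a * s)      <⟨ +-monoˡ-< (A + a * s) (m<m+n R (s≤s z≤n)) ⟩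
    s + (A + a * s)      ≡⟨ x∙yz≈y∙xz s A (a * s) ⟩
    A + suc a * s        ≤⟨ +-mono-≤ A≤W (*-monoˡ-≤ s a<b) ⟩
    W + b * s            ≤⟨ +-monoʳ-≤ W (m≤n+m (b * s) B) ⟩
    W + (B + b * s)      ∎
    where
    open ≤-Reasoning
    s = R + 1

  module _ {G : Graph} (w : Fin (m G) → ℕ) (M : EdgeSet G) (R : ℕ) where

    w′-as-difference : ∀ e → w′ G w M (+ R) e ≡
                       + (if not (M e) then w e + (R + 1) else 0) - + (if M e then w e + (R + 1) else 0)
    w′-as-difference e with M e
    ... | true  = negative (+ w e) (+ R)
      where
      negative : ∀ x y → ℤ.- x - y - + 1 ≡ + 0 - (x ℤ.+ (y ℤ.+ + 1))
      negative = solve-∀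
    ... | false = positive (+ w e) (+ R)
      where
      positive : ∀ x y → x ℤ.+ y ℤ.+ + 1 ≡ (x ℤ.+ (y ℤ.+ + 1)) - + 0
      positive = solve-∀

    module _ (C : Cycle G) where

      abs-w′ : (Fin (len C) → Bool) → ℕ
      abs-w′ p = sumWhere (len C) p (w ∘ edge C) + count (len C) p * (R + 1)

      abs-w′-sum : ∀ p → sumWhere (len C) p (λ i → w (edge C i) + (R + 1)) ≡ abs-w′ p
      abs-w′-sum p = trans (sumWhere-+ (len C) p _ _) (cong (_+_ _) (sumWhere-const (len C) p (R + 1)))

      cycleWeight-w′ : cycleWeight (w′ G w M (+ R)) C ≡ + abs-w′ (not ∘ onM M C) - + abs-w′ (onM M C)
      cycleWeight-w′ =
        trans (sumℤ-difference (len C) _ _ _ (w′-as-difference ∘ edge C))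
              (cong₂ (λ x y → + x - + y) (abs-w′-sum (not ∘ onM M C)) (abs-w′-sum (onM M C)))

  module _ {G : Graph} {w : Fin (m G) → ℕ} {M : EdgeSet G} (minimal : IsMinWeightPerfectMatching G w M)
           (R : ℕ) (C : Cycle G) where

    private
      perfect = proj₁ minimal
      L = len C
      on off : Fin L → Bool
      on  = onM M C
      off = not ∘ onM M C

    balanced-or-heavy : count L on ≡ count L off ⊎
                        R + abs-w′ w M R C on < weight G w M + abs-w′ w M R C off
    balanced-or-heavy with m≤n⇒m<n∨m≡n (count-onM≤count-offM perfect C)
    ... | inj₁ unbalanced = inj₂ (unbalanced-gap R unbalanced (weight-onM≤weight w M C))
    ... | inj₂ balanced   = inj₁ balanced

    light⇒alternating : cycleWeight (w′ G w M (+ R)) C ℤ.≤ + R - + weight G w M → IsAlternating M C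
    light⇒alternating light with balanced-or-heavy
    ... | inj₁ balanced = balanced⇒alternating perfect C balanced
    ... | inj₂ heavy    = contradiction (differences-≤ {u = R} {v = weight G w M}
                            (subst (ℤ._≤ + R - + weight G w M) (cycleWeight-w′ w M R C) light)) (<⇒≱ heavy)

    w′-cycle-nonnegative : weight G w M ≤ R → + 0 ℤ.≤ cycleWeight (w′ G w M (+ R)) C
    w′-cycle-nonnegative W≤R =
      subst (ℤ._≤_ (+ 0)) (sym (cycleWeight-w′ w M R C)) (i≤j⇒0≤j-i (+≤+ abs-w′-on≤abs-w′-off))
      where
      abs-w′-on≤abs-w′-off : abs-w′ w M R C on ≤ abs-w′ w M R C off
      abs-w′-on≤abs-w′-off with balanced-or-heavy
      ... | inj₁ balanced = +-mono-≤
        (alternating⇒weight-onM≤weight-offM minimal C (proj₂ (balanced⇒alternating perfect C balanced)))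
        (≤-reflexive (cong (_* (R + 1)) balanced))
      ... | inj₂ heavy    = <⇒≤ (+-cancelˡ-< R _ _ (<-≤-trans heavy (+-monoˡ-≤ _ W≤R)))

open import Data.Integer using (_≤_)

mainTheorem6 : (G : Graph) (w : Fin (m G) → ℕ) (M : EdgeSet G)
    → IsMinWeightPerfectMatching G w M
    → (r : ℤ) → + weight G w M ≤ r
    → (∀ (C : Cycle G) → cycleWeight (w′ G w M r) C ≤ r - + weight G w M → IsAlternating M C)
    × Conservative G (w′ G w M r)
mainTheorem6 G w M minimal (+ R) (+≤+ W≤R) =
  light⇒alternating minimal R , λ C → w′-cycle-nonnegative minimal R C W≤R
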